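{- For every $n\ge4$, $\#\mathrm{Av}_n([1243],[1342])=4$.
   Context: For a linear permutation $\pi=\pi_1\ldots\pi_n$ of $[n]$, the cyclic permutation $[\pi]$ is the set of all rotations of $\pi$. A linear permutation $\sigma$ contains $\pi$ if some subsequence of $\sigma$ is order isomorphic to $\pi$ (same relative order). A cyclic permutation $[\sigma]$ contains $[\pi]$ if some rotation of $\sigma$ contains $\pi$; otherwise it avoids $[\pi]$. For a set of cyclic patterns $[\Pi]$, $\mathrm{Av}_n[\Pi]$ denotes the set of cyclic permutations of length $n$ avoiding every pattern in $[\Pi]$. -}

module Defs where

open import Data.Nat using (ℕ; _<_)
open import Data.List using (List; []; _∷_; length; drop; take; _++_; upTo; zip)
open import Data.List.Relation.Unary.All using (All)
open import Data.List.Relation.Binary.Sublist.Propositional using (_⊆_)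
open import Data.List.Relation.Binary.Permutation.Propositional using (_↭_)
open import Data.Product using (Σ; ∃; ∃-syntax; _×_; _,_)
open import Data.Unit using (⊤)
open import Relation.Nullary using (¬_)
open import Relation.Binary.PropositionalEquality using (_≡_)
open import Function.Bundles using (_⇔_)

-- A linear permutation of [n], written with values 0,…,n-1
-- (the value set is irrelevant for pattern questions).
IsPerm : ℕ → List ℕ → Set
IsPerm n xs = xs ↭ upTo n

SameOrder : List (ℕ × ℕ) → Set
SameOrder [] = ⊤
SameOrder ((a , b) ∷ ps) =
  All (λ q → ((a < Data.Product.proj₁ q) ⇔ (b < Data.Product.proj₂ q))
           × ((Data.Product.proj₁ q < a) ⇔ (Data.Product.proj₂ q < b))) ps
  × SameOrder ps

OrderIso : List ℕ → List ℕ → Set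
OrderIso xs ys = (length xs ≡ length ys) × SameOrder (zip xs ys)

Contains : List ℕ → List ℕ → Set
Contains σ π = ∃[ τ ] (τ ⊆ σ × OrderIso τ π)

rotate : ℕ → List ℕ → List ℕ
rotate k xs = drop k xs ++ take k xs

CycContains : List ℕ → List ℕ → Set
CycContains σ π = ∃[ k ] (k < length σ × Contains (rotate k σ) π)

SameCyclic : List ℕ → List ℕ → Set
SameCyclic σ τ = ∃[ k ] (k < length σ × rotate k σ ≡ τ)

p1243 : List ℕ
p1243 = 0 ∷ 1 ∷ 3 ∷ 2 ∷ []

p1342 : List ℕ
p1342 = 0 ∷ 2 ∷ 3 ∷ 1 ∷ []

-- σ is (a representative of) a cyclic permutation in Av_n([1243],[1342])
InAv : ℕ → List ℕ → Set
InAv n σ = IsPerm n σ × ¬ CycContains σ p1243 × ¬ CycContains σ p1342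

-- Rotating the minimum 0 to the front, the four classes are represented by
-- 0 1 … (n−1),  0 (n−1) … 1,  0 (n−1) 1 … (n−2)  and  0 (n−2) … 1 (n−1).
-- A 4-element cyclic pattern lies in [1243] ∪ [1342] exactly when its minimum
-- and maximum are not cyclically adjacent; none of the four lists contains such
-- a quadruple, and they are pairwise non-rotations since each begins with its
-- minimum. Completeness is by induction on n: deleting the maximum n of an
-- avoider leaves an avoider, hence a rotation of a representative of length n,
-- and inserting n at any position of a representative either gives a
-- representative of length n + 1 up to rotation or creates one of the two
-- patterns. Below length 4 the classes are different and are handled directly.

module Submission where

open import Level using (Level)
open import Data.Nat using (ℕ; zero; suc; pred; _∸_; _+_; _≤_; _<_; _>_; s≤s; z<s; s<s)
open import Data.Nat.Properties
  using (<-asym; <-trans; <-irrefl; ≤-refl; <⇒≤; n<1+n; m<n⇒m<1+n; m≤m+n; m<m+n; +-suc; +-identityʳ)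
open import Data.Fin using (Fin)
import Data.Fin as Fin
open import Data.List using (List; []; _∷_; _++_; [_]; length; drop; take; lookup; upTo)
open import Data.List.Properties using (length-++; ++-assoc; ++-identityʳ; ∷-injective; take++drop≡id; upTo-∷ʳ)
open import Data.List.Relation.Unary.All using (All; []; _∷_)
import Data.List.Relation.Unary.All as All
import Data.List.Relation.Unary.All.Properties as Allₚ
open import Data.List.Relation.Unary.AllPairs using (AllPairs; []; _∷_)
open import Data.List.Relation.Unary.Unique.Propositional using (Unique)
open import Data.List.Relation.Unary.Any using (here; there; index)
open import Data.List.Relation.Unary.Any.Properties using (lookup-index)
open import Data.List.Membership.Propositional using (_∈_)
open import Data.List.Membership.Propositional.Properties using (∈-∃++; ∈-++⁺ˡ; ∈-++⁺ʳ; ∈-lookup)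
open import Data.List.Relation.Binary.Sublist.Propositional
  using (_⊆_; []; _∷_; _∷ʳ_; ⊆-refl; ⊆-trans; minimum; from∈)
open import Data.List.Relation.Binary.Sublist.Propositional.Properties
  using (++⁺; All-resp-⊆)
open import Data.List.Relation.Binary.Permutation.Propositional
  using (_↭_; ↭-refl; ↭-sym; ↭-trans; ↭-reflexive; prep)
open import Data.List.Relation.Binary.Permutation.Propositional.Properties
  using (↭-empty-inv; ∈-resp-↭; drop-mid; ∷↭∷ʳ)
import Data.List.Relation.Binary.Permutation.Propositional.Properties as ↭
open import Data.Product using (Σ; ∃₂; ∃-syntax; _×_; _,_; proj₁; proj₂)
open import Data.Sum using (_⊎_; inj₁; inj₂)
open import Data.Empty using (⊥; ⊥-elim)
open import Data.Unit using (tt)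
open import Relation.Nullary using (¬_)
open import Relation.Binary.PropositionalEquality
  using (_≡_; refl; sym; trans; cong; cong₂; subst; module ≡-Reasoning)
open import Function.Base using (_∘_)
open import Function.Bundles using (_⇔_; Equivalence; mk⇔)

open import Defs

private
  variable
    a : Level
    A : Set a

++-≡-++-split : (xs ys us vs : List A) → xs ++ ys ≡ us ++ vs →
  (∃[ ws ] (us ≡ xs ++ ws × ys ≡ ws ++ vs)) ⊎ (∃[ ws ] (xs ≡ us ++ ws × vs ≡ ws ++ ys))
++-≡-++-split []       ys us       vs eq = inj₁ (us , refl , eq)
++-≡-++-split (x ∷ xs) ys []       vs eq = inj₂ (x ∷ xs , refl , sym eq)
++-≡-++-split (x ∷ xs) ys (u ∷ us) vs eq with ∷-injective eq
... | refl , eq′ with ++-≡-++-split xs ys us vs eq′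
...   | inj₁ (ws , refl , e) = inj₁ (ws , refl , e)
...   | inj₂ (ws , refl , e) = inj₂ (ws , refl , e)

drop-length-++ : (xs ys : List A) → drop (length xs) (xs ++ ys) ≡ ys
drop-length-++ []       ys = refl
drop-length-++ (x ∷ xs) ys = drop-length-++ xs ys

take-length-++ : (xs ys : List A) → take (length xs) (xs ++ ys) ≡ xs
take-length-++ []       ys = refl
take-length-++ (x ∷ xs) ys = cong (x ∷_) (take-length-++ xs ys)

⊆-++-split : ∀ {τ} (xs ys : List A) → τ ⊆ xs ++ ys →
  ∃₂ λ τ₁ τ₂ → τ ≡ τ₁ ++ τ₂ × τ₁ ⊆ xs × τ₂ ⊆ ys
⊆-++-split []       ys t = [] , _ , refl , [] , t
⊆-++-split (x ∷ xs) ys (.x ∷ʳ t) with ⊆-++-split xs ys t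
... | τ₁ , τ₂ , e , t₁ , t₂ = τ₁ , τ₂ , e , x ∷ʳ t₁ , t₂
⊆-++-split (x ∷ xs) ys (refl ∷ t) with ⊆-++-split xs ys t
... | τ₁ , τ₂ , refl , t₁ , t₂ = x ∷ τ₁ , τ₂ , refl , refl ∷ t₁ , t₂

AllPairs-resp-⊆ : ∀ {R : A → A → Set} {xs ys} → xs ⊆ ys → AllPairs R ys → AllPairs R xs
AllPairs-resp-⊆ []        []       = []
AllPairs-resp-⊆ (y ∷ʳ t)  (_ ∷ ps) = AllPairs-resp-⊆ t ps
AllPairs-resp-⊆ (refl ∷ t) (p ∷ ps) = All-resp-⊆ t p ∷ AllPairs-resp-⊆ t ps

↭-∷ʳ⁻ : ∀ (x : A) {σ xs} → σ ↭ xs ++ [ x ] → ∃₂ λ us vs → σ ≡ us ++ x ∷ vs × us ++ vs ↭ xs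
↭-∷ʳ⁻ x {xs = xs} p with ∈-∃++ (∈-resp-↭ (↭-sym p) (∈-++⁺ʳ xs (here refl)))
... | us , vs , refl = us , vs , refl , ↭-trans (drop-mid us xs p) (↭-reflexive (++-identityʳ xs))

lookup-injective : ∀ {xs : List A} → Unique xs → ∀ {i j} → lookup xs i ≡ lookup xs j → i ≡ j
lookup-injective (_ ∷ _)   {Fin.zero}  {Fin.zero}  _ = refl
lookup-injective (x≢ ∷ _)  {Fin.zero}  {Fin.suc j} e = ⊥-elim (All.lookup x≢ (∈-lookup j) e)
lookup-injective (x≢ ∷ _)  {Fin.suc i} {Fin.zero}  e = ⊥-elim (All.lookup x≢ (∈-lookup i) (sym e))
lookup-injective (_ ∷ xs!) {Fin.suc i} {Fin.suc j} e = cong Fin.suc (lookup-injective xs! e)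

infix 4 _↻_

_↻_ : List A → List A → Set _
σ ↻ τ = ∃₂ λ us vs → σ ≡ us ++ vs × τ ≡ vs ++ us

↻-swap : (us vs : List A) → us ++ vs ↻ vs ++ us
↻-swap us vs = us , vs , refl , refl

↻-reflexive : {σ τ : List A} → σ ≡ τ → σ ↻ τ
↻-reflexive {σ = σ} refl = σ , [] , sym (++-identityʳ σ) , refl

↻-refl : {σ : List A} → σ ↻ σ
↻-refl = ↻-reflexive refl

↻-sym : {σ τ : List A} → σ ↻ τ → τ ↻ σ
↻-sym (us , vs , e , e′) = vs , us , e′ , e

↻-trans : {σ ρ τ : List A} → σ ↻ ρ → ρ ↻ τ → σ ↻ τ
↻-trans (us , vs , refl , refl) (us′ , vs′ , e , refl) with ++-≡-++-split vs us us′ vs′ e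
... | inj₁ (ws , refl , refl) = ws , vs′ ++ vs , ++-assoc ws vs′ vs , sym (++-assoc vs′ vs ws)
... | inj₂ (ws , refl , refl) = us ++ us′ , ws , sym (++-assoc us us′ ws) , ++-assoc ws us us′

↻-insert : ∀ {xs ys τ : List A} x → xs ++ ys ↻ τ →
  ∃₂ λ ps qs → τ ≡ ps ++ qs × xs ++ x ∷ ys ↻ ps ++ x ∷ qs
↻-insert {xs = xs} {ys} x (us , vs , e , refl) with ++-≡-++-split xs ys us vs e
... | inj₁ (ws , refl , refl) = vs ++ xs , ws , sym (++-assoc vs xs ws) ,
      xs ++ x ∷ ws , vs , sym (++-assoc xs (x ∷ ws) vs) , ++-assoc vs xs (x ∷ ws)
... | inj₂ (ws , refl , refl) = ws , ys ++ us , ++-assoc ws ys us ,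
      us , ws ++ x ∷ ys , ++-assoc us ws (x ∷ ys) , sym (++-assoc ws (x ∷ ys) us)

rotate-↻ : ∀ k (σ : List ℕ) → σ ↻ rotate k σ
rotate-↻ k σ = take k σ , drop k σ , sym (take++drop≡id k σ) , refl

↻⇒SameCyclic : ∀ {σ τ : List ℕ} → σ ↻ τ → 0 < length τ → SameCyclic σ τ
↻⇒SameCyclic (us , [] , refl , refl) 0<∣us∣ =
  0 , subst (λ xs → 0 < length xs) (sym (++-identityʳ us)) 0<∣us∣ ,
  trans (++-identityʳ (us ++ [])) (++-identityʳ us)
↻⇒SameCyclic (us , v ∷ vs , refl , refl) _ =
  length us , subst (length us <_) (sym (length-++ us)) (m<m+n (length us) z<s) ,
  cong₂ _++_ (drop-length-++ us (v ∷ vs)) (take-length-++ us (v ∷ vs))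

RotContains : List ℕ → List ℕ → Set
RotContains σ π = ∃[ ρ ] (σ ↻ ρ × Contains ρ π)

cycContains⇒rotContains : ∀ {σ π} → CycContains σ π → RotContains σ π
cycContains⇒rotContains {σ} (k , _ , c) = rotate k σ , rotate-↻ k σ , c

contains-nonempty : ∀ {ρ x π} → Contains ρ (x ∷ π) → 0 < length ρ
contains-nonempty ([]    , _      , () , _)
contains-nonempty (_ ∷ _ , _ ∷ʳ _ , _) = z<s
contains-nonempty (_ ∷ _ , _ ∷ _  , _) = z<s

rotContains⇒cycContains : ∀ {σ x π} → RotContains σ (x ∷ π) → CycContains σ (x ∷ π)
rotContains⇒cycContains (ρ , σ↻ρ , c) with ↻⇒SameCyclic σ↻ρ (contains-nonempty c)
... | k , k< , refl = k , k< , c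

rotContains-insert : ∀ xs ys n {π} → RotContains (xs ++ ys) π → RotContains (xs ++ n ∷ ys) π
rotContains-insert xs ys n (ρ , r , τ , τ⊆ρ , iso) with ↻-insert n r
... | ps , qs , refl , r′ = ps ++ n ∷ qs , r′ , τ , ⊆-trans τ⊆ρ (++⁺ ⊆-refl (n ∷ʳ ⊆-refl)) , iso

rotContains-↻ : ∀ {σ τ π} → σ ↻ τ → RotContains τ π → RotContains σ π
rotContains-↻ r (ρ , r′ , c) = ρ , ↻-trans r r′ , c

Avoids : List ℕ → Set
Avoids σ = ¬ RotContains σ p1243 × ¬ RotContains σ p1342

Avoids-↻ : ∀ {σ τ} → σ ↻ τ → Avoids σ → Avoids τ
Avoids-↻ r (¬c₁ , ¬c₂) = ¬c₁ ∘ rotContains-↻ r , ¬c₂ ∘ rotContains-↻ r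

Avoids-delete : ∀ xs ys n → Avoids (xs ++ n ∷ ys) → Avoids (xs ++ ys)
Avoids-delete xs ys n (¬c₁ , ¬c₂) =
  ¬c₁ ∘ rotContains-insert xs ys n , ¬c₂ ∘ rotContains-insert xs ys n

InAv⇒Avoids : ∀ {n σ} → InAv n σ → Avoids σ
InAv⇒Avoids (_ , ¬c₁ , ¬c₂) = ¬c₁ ∘ rotContains⇒cycContains , ¬c₂ ∘ rotContains⇒cycContains

<⇒related : ∀ {u v p q} → u < v → p < q → (u < v ⇔ p < q) × (v < u ⇔ q < p)
<⇒related u<v p<q = mk⇔ (λ _ → p<q) (λ _ → u<v) , mk⇔ (⊥-elim ∘ <-asym u<v) (⊥-elim ∘ <-asym p<q)

>⇒related : ∀ {u v p q} → v < u → q < p → (u < v ⇔ p < q) × (v < u ⇔ q < p)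
>⇒related v<u q<p = mk⇔ (⊥-elim ∘ <-asym v<u) (⊥-elim ∘ <-asym q<p) , mk⇔ (λ _ → q<p) (λ _ → v<u)

contains-1243 : ∀ {ρ a b c d} → (a ∷ b ∷ c ∷ d ∷ []) ⊆ ρ → a < b → b < d → d < c → Contains ρ p1243
contains-1243 t a<b b<d d<c =
  _ , t , refl ,
  (<⇒related a<b z<s ∷ <⇒related a<c z<s ∷ <⇒related a<d z<s ∷ []) ,
  (<⇒related b<c (s<s z<s) ∷ <⇒related b<d (s<s z<s) ∷ []) ,
  (>⇒related d<c (s<s (s<s z<s)) ∷ []) , [] , tt
  where
  a<d = <-trans a<b b<d
  b<c = <-trans b<d d<c
  a<c = <-trans a<b b<c

contains-1342 : ∀ {ρ a b c d} → (a ∷ b ∷ c ∷ d ∷ []) ⊆ ρ → a < d → d < b → b < c → Contains ρ p1342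
contains-1342 t a<d d<b b<c =
  _ , t , refl ,
  (<⇒related a<b z<s ∷ <⇒related a<c z<s ∷ <⇒related a<d z<s ∷ []) ,
  (<⇒related b<c (s<s (s<s z<s)) ∷ >⇒related d<b (s<s z<s) ∷ []) ,
  (>⇒related d<c (s<s z<s) ∷ []) , [] , tt
  where
  a<b = <-trans a<d d<b
  d<c = <-trans d<b b<c
  a<c = <-trans a<b b<c

refute-1243 : ∀ {σ ρ a b c d} → Avoids σ → σ ↻ ρ → (a ∷ b ∷ c ∷ d ∷ []) ⊆ ρ →
  a < b → b < d → d < c → ⊥
refute-1243 (¬c , _) r t a<b b<d d<c = ¬c (_ , r , contains-1243 t a<b b<d d<c)

refute-1342 : ∀ {σ ρ a b c d} → Avoids σ → σ ↻ ρ → (a ∷ b ∷ c ∷ d ∷ []) ⊆ ρ →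
  a < d → d < b → b < c → ⊥
refute-1342 (_ , ¬c) r t a<d d<b b<c = ¬c (_ , r , contains-1342 t a<d d<b b<c)

-- These are exactly the quadruples order isomorphic to 1243 or 1342, so a cyclic
-- occurrence of either pattern is a linear occurrence of a rotation of one.
Opposed : List ℕ → Set
Opposed (a ∷ b ∷ c ∷ d ∷ []) = a < b × a < d × b < c × d < c
Opposed _                     = ⊥

data CyclicallyOpposed (w x y z : ℕ) : Set where
  rot₀ : Opposed (w ∷ x ∷ y ∷ z ∷ []) → CyclicallyOpposed w x y z
  rot₁ : Opposed (z ∷ w ∷ x ∷ y ∷ []) → CyclicallyOpposed w x y z
  rot₂ : Opposed (y ∷ z ∷ w ∷ x ∷ []) → CyclicallyOpposed w x y z
  rot₃ : Opposed (x ∷ y ∷ z ∷ w ∷ []) → CyclicallyOpposed w x y z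

HasOpposed : List ℕ → Set
HasOpposed σ = ∃[ w ] ∃[ x ] ∃[ y ] ∃[ z ] ((w ∷ x ∷ y ∷ z ∷ []) ⊆ σ × CyclicallyOpposed w x y z)

CyclicallyOpposed-rotate : ∀ {w x y z} → CyclicallyOpposed w x y z → CyclicallyOpposed x y z w
CyclicallyOpposed-rotate (rot₀ o) = rot₁ o
CyclicallyOpposed-rotate (rot₁ o) = rot₂ o
CyclicallyOpposed-rotate (rot₂ o) = rot₃ o
CyclicallyOpposed-rotate (rot₃ o) = rot₀ o

-- Under these hypotheses the minimum and the maximum of w x y z are cyclically adjacent.
below-neighbours⇒¬CyclicallyOpposed : ∀ {w x y z} → w < x → w < z → y < x ⊎ y < z →
  ¬ CyclicallyOpposed w x y z
below-neighbours⇒¬CyclicallyOpposed w<x w<z (inj₁ y<x) (rot₀ (_ , _ , x<y , _)) = <-asym x<y y<x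
below-neighbours⇒¬CyclicallyOpposed w<x w<z (inj₂ y<z) (rot₀ (_ , _ , _ , z<y)) = <-asym z<y y<z
below-neighbours⇒¬CyclicallyOpposed w<x w<z _ (rot₁ (z<w , _ , _ , _)) = <-asym w<z z<w
below-neighbours⇒¬CyclicallyOpposed w<x w<z _ (rot₂ (_ , _ , z<w , _)) = <-asym w<z z<w
below-neighbours⇒¬CyclicallyOpposed w<x w<z _ (rot₃ (_ , x<w , _ , _)) = <-asym w<x x<w

increasing⇒¬CyclicallyOpposed : ∀ {w x y z} →
  AllPairs _<_ (w ∷ x ∷ y ∷ z ∷ []) → ¬ CyclicallyOpposed w x y z
increasing⇒¬CyclicallyOpposed ((w<x ∷ _ ∷ w<z ∷ []) ∷ _ ∷ (y<z ∷ []) ∷ _) =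
  below-neighbours⇒¬CyclicallyOpposed w<x w<z (inj₂ y<z)

decreasing⇒¬CyclicallyOpposed : ∀ {w x y z} →
  AllPairs _>_ (w ∷ x ∷ y ∷ z ∷ []) → ¬ CyclicallyOpposed w x y z
decreasing⇒¬CyclicallyOpposed ((x<w ∷ _ ∷ z<w ∷ []) ∷ _ ∷ (z<y ∷ []) ∷ _) =
  below-neighbours⇒¬CyclicallyOpposed z<w z<y (inj₁ x<w)
    ∘ CyclicallyOpposed-rotate ∘ CyclicallyOpposed-rotate ∘ CyclicallyOpposed-rotate

↻-opposed : ∀ {σ ρ τ} → σ ↻ ρ → τ ⊆ ρ → Opposed τ → HasOpposed σ
↻-opposed {τ = a ∷ b ∷ c ∷ d ∷ []} (us , vs , refl , refl) t o with ⊆-++-split vs us t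
... | []                    , _  , refl , t₁ , t₂ = a , b , c , d , ++⁺ t₂ t₁ , rot₀ o
... | _ ∷ []                , _  , refl , t₁ , t₂ = b , c , d , a , ++⁺ t₂ t₁ , rot₁ o
... | _ ∷ _ ∷ []            , _  , refl , t₁ , t₂ = c , d , a , b , ++⁺ t₂ t₁ , rot₂ o
... | _ ∷ _ ∷ _ ∷ []        , _  , refl , t₁ , t₂ = d , a , b , c , ++⁺ t₂ t₁ , rot₃ o
... | _ ∷ _ ∷ _ ∷ _ ∷ []    , [] , refl , t₁ , t₂ = a , b , c , d , ++⁺ t₂ t₁ , rot₀ o

open Equivalence using (from)

orderIso-1243⇒Opposed : ∀ τ → OrderIso τ p1243 → Opposed τ
orderIso-1243⇒Opposed (a ∷ b ∷ c ∷ d ∷ []) (_ , (a~b ∷ _ ∷ a~d ∷ []) , (b~c ∷ _) , (c~d ∷ []) , _) =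
  from (proj₁ a~b) z<s , from (proj₁ a~d) z<s ,
  from (proj₁ b~c) (s<s z<s) , from (proj₂ c~d) (s<s (s<s z<s))
orderIso-1243⇒Opposed []                    (() , _)
orderIso-1243⇒Opposed (_ ∷ [])              (() , _)
orderIso-1243⇒Opposed (_ ∷ _ ∷ [])          (() , _)
orderIso-1243⇒Opposed (_ ∷ _ ∷ _ ∷ [])      (() , _)
orderIso-1243⇒Opposed (_ ∷ _ ∷ _ ∷ _ ∷ _ ∷ _) (() , _)

orderIso-1342⇒Opposed : ∀ τ → OrderIso τ p1342 → Opposed τ
orderIso-1342⇒Opposed (a ∷ b ∷ c ∷ d ∷ []) (_ , (a~b ∷ _ ∷ a~d ∷ []) , (b~c ∷ _) , (c~d ∷ []) , _) =
  from (proj₁ a~b) z<s , from (proj₁ a~d) z<s ,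
  from (proj₁ b~c) (s<s (s<s z<s)) , from (proj₂ c~d) (s<s z<s)
orderIso-1342⇒Opposed []                    (() , _)
orderIso-1342⇒Opposed (_ ∷ [])              (() , _)
orderIso-1342⇒Opposed (_ ∷ _ ∷ [])          (() , _)
orderIso-1342⇒Opposed (_ ∷ _ ∷ _ ∷ [])      (() , _)
orderIso-1342⇒Opposed (_ ∷ _ ∷ _ ∷ _ ∷ _ ∷ _) (() , _)

rotContains⇒HasOpposed : ∀ {σ π} → (∀ τ → OrderIso τ π → Opposed τ) →
  RotContains σ π → HasOpposed σ
rotContains⇒HasOpposed decode (_ , r , τ , t , iso) = ↻-opposed r t (decode τ iso)

¬HasOpposed⇒InAv : ∀ {n σ τ} → IsPerm n σ → σ ↻ τ → ¬ HasOpposed τ → InAv n σ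
¬HasOpposed⇒InAv {σ = σ} perm r ¬opp =
  perm , excludes orderIso-1243⇒Opposed , excludes orderIso-1342⇒Opposed
  where
  excludes : ∀ {π} → (∀ τ → OrderIso τ π → Opposed τ) → ¬ CycContains σ π
  excludes decode =
    ¬opp ∘ rotContains⇒HasOpposed decode ∘ rotContains-↻ (↻-sym r) ∘ cycContains⇒rotContains

increasing⇒¬HasOpposed : ∀ {σ} → AllPairs _<_ σ → ¬ HasOpposed σ
increasing⇒¬HasOpposed inc (_ , _ , _ , _ , t , o) =
  increasing⇒¬CyclicallyOpposed (AllPairs-resp-⊆ t inc) o

decreasing⇒¬HasOpposed : ∀ {σ} → AllPairs _>_ σ → ¬ HasOpposed σ
decreasing⇒¬HasOpposed dec (_ , _ , _ , _ , t , o) =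
  decreasing⇒¬CyclicallyOpposed (AllPairs-resp-⊆ t dec) o

min∷decreasing⇒¬HasOpposed : ∀ {m L} → All (m <_) L → AllPairs _>_ L → ¬ HasOpposed (m ∷ L)
min∷decreasing⇒¬HasOpposed m<L dec (_ , _ , _ , _ , refl ∷ t , o)
  with All-resp-⊆ t m<L | AllPairs-resp-⊆ t dec
... | m<x ∷ _ ∷ m<z ∷ [] | (y<x ∷ _) ∷ _ = below-neighbours⇒¬CyclicallyOpposed m<x m<z (inj₁ y<x) o
min∷decreasing⇒¬HasOpposed m<L dec (_ , _ , _ , _ , _ ∷ʳ t , o) =
  decreasing⇒¬HasOpposed dec (_ , _ , _ , _ , t , o)

max∷increasing⇒¬HasOpposed : ∀ {M I} → All (_< M) I → AllPairs _<_ I → ¬ HasOpposed (M ∷ I)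
max∷increasing⇒¬HasOpposed I<M inc (_ , _ , _ , _ , refl ∷ t , o)
  with All-resp-⊆ t I<M | AllPairs-resp-⊆ t inc
... | x<M ∷ _ ∷ z<M ∷ [] | (x<y ∷ _) ∷ _ =
  below-neighbours⇒¬CyclicallyOpposed x<y x<M (inj₂ z<M) (CyclicallyOpposed-rotate o)
max∷increasing⇒¬HasOpposed I<M inc (_ , _ , _ , _ , _ ∷ʳ t , o) =
  increasing⇒¬HasOpposed inc (_ , _ , _ , _ , t , o)

min∷max∷increasing⇒¬HasOpposed : ∀ {m M I} → m < M → All (m <_) I → All (_< M) I → AllPairs _<_ I →
  ¬ HasOpposed (m ∷ M ∷ I)
min∷max∷increasing⇒¬HasOpposed m<M m<I I<M inc (_ , _ , _ , _ , refl ∷ refl ∷ t , o)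
  with All-resp-⊆ t m<I | All-resp-⊆ t I<M
... | _ ∷ m<z ∷ [] | y<M ∷ _ ∷ [] = below-neighbours⇒¬CyclicallyOpposed m<M m<z (inj₁ y<M) o
min∷max∷increasing⇒¬HasOpposed m<M m<I I<M inc (_ , _ , _ , _ , refl ∷ (_ ∷ʳ t) , o) =
  increasing⇒¬HasOpposed (m<I ∷ inc) (_ , _ , _ , _ , refl ∷ t , o)
min∷max∷increasing⇒¬HasOpposed m<M m<I I<M inc (_ , _ , _ , _ , _ ∷ʳ t , o) =
  max∷increasing⇒¬HasOpposed I<M inc (_ , _ , _ , _ , t , o)

max∷min∷decreasing⇒¬HasOpposed : ∀ {m M L} → m < M → All (m <_) L → All (_< M) L → AllPairs _>_ L →
  ¬ HasOpposed (M ∷ m ∷ L)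
max∷min∷decreasing⇒¬HasOpposed m<M m<L L<M dec (_ , _ , _ , _ , refl ∷ refl ∷ t , o)
  with All-resp-⊆ t m<L | AllPairs-resp-⊆ t dec
... | m<y ∷ _ ∷ [] | (z<y ∷ []) ∷ _ =
  below-neighbours⇒¬CyclicallyOpposed m<y m<M (inj₁ z<y) (CyclicallyOpposed-rotate o)
max∷min∷decreasing⇒¬HasOpposed m<M m<L L<M dec (_ , _ , _ , _ , refl ∷ (_ ∷ʳ t) , o) =
  decreasing⇒¬HasOpposed (L<M ∷ dec) (_ , _ , _ , _ , refl ∷ t , o)
max∷min∷decreasing⇒¬HasOpposed m<M m<L L<M dec (_ , _ , _ , _ , _ ∷ʳ t , o) =
  min∷decreasing⇒¬HasOpposed m<L dec (_ , _ , _ , _ , t , o)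

up : ℕ → ℕ → List ℕ
up a zero    = []
up a (suc k) = a ∷ up (suc a) k

down : ℕ → ℕ → List ℕ
down j zero    = []
down j (suc i) = suc (j + i) ∷ down j i

up-lowerBound : ∀ a k → All (a ≤_) (up a k)
up-lowerBound a zero    = []
up-lowerBound a (suc k) = ≤-refl ∷ All.map <⇒≤ (up-lowerBound (suc a) k)

up-upperBound : ∀ a k → All (_< a + k) (up a k)
up-upperBound a zero    = []
up-upperBound a (suc k) rewrite +-suc a k = s≤s (m≤m+n a k) ∷ up-upperBound (suc a) k

up-increasing : ∀ a k → AllPairs _<_ (up a k)
up-increasing a zero    = []
up-increasing a (suc k) = up-lowerBound (suc a) k ∷ up-increasing (suc a) k

up-∷ʳ : ∀ a k → up a (suc k) ≡ up a k ++ [ a + k ]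
up-∷ʳ a zero    = cong [_] (sym (+-identityʳ a))
up-∷ʳ a (suc k) rewrite +-suc a k = cong (a ∷_) (up-∷ʳ (suc a) k)

up≡upTo : ∀ n → up 0 n ≡ upTo n
up≡upTo zero    = refl
up≡upTo (suc n) = trans (up-∷ʳ 0 n) (trans (cong (_++ [ n ]) (up≡upTo n)) (upTo-∷ʳ n))

∈-up-last : ∀ a k → a + k ∈ up a (suc k)
∈-up-last a k = subst (a + k ∈_) (sym (up-∷ʳ a k)) (∈-++⁺ʳ (up a k) (here refl))

up-split : ∀ a k ps qs → up a k ≡ ps ++ qs →
  ∃₂ λ i j → i + j ≡ k × ps ≡ up a i × qs ≡ up (a + i) j
up-split a k       []       qs e =
  0 , k , refl , refl , trans (sym e) (cong (λ b → up b k) (sym (+-identityʳ a)))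
up-split a (suc k) (p ∷ ps) qs e with ∷-injective e
... | refl , e′ with up-split (suc a) k ps qs e′
...   | i , j , refl , refl , refl = suc i , j , refl , refl , cong (λ b → up b j) (sym (+-suc a i))

down-lowerBound : ∀ j i → All (j <_) (down j i)
down-lowerBound j zero    = []
down-lowerBound j (suc i) = s≤s (m≤m+n j i) ∷ down-lowerBound j i

down-upperBound : ∀ j i → All (_< suc (j + i)) (down j i)
down-upperBound j zero    = []
down-upperBound j (suc i) rewrite +-suc j i =
  n<1+n (suc (j + i)) ∷ All.map m<n⇒m<1+n (down-upperBound j i)

down-decreasing : ∀ j i → AllPairs _>_ (down j i)
down-decreasing j zero    = []
down-decreasing j (suc i) = down-upperBound j i ∷ down-decreasing j i

down-++ : ∀ j i → down j i ++ down 0 j ≡ down 0 (j + i)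
down-++ j zero    = cong (down 0) (sym (+-identityʳ j))
down-++ j (suc i) rewrite +-suc j i = cong (suc (j + i) ∷_) (down-++ j i)

∈-down-last : ∀ j i → suc j ∈ down j (suc i)
∈-down-last j zero    = here (cong suc (sym (+-identityʳ j)))
∈-down-last j (suc i) = there (∈-down-last j i)

down-split : ∀ k ps qs → down 0 k ≡ ps ++ qs →
  ∃₂ λ i j → j + i ≡ k × ps ≡ down j i × qs ≡ down 0 j
down-split k       []       qs e = 0 , k , +-identityʳ k , refl , sym e
down-split (suc k) (p ∷ ps) qs e with ∷-injective e
... | refl , e′ with down-split k ps qs e′
...   | i , j , refl , refl , refl = suc i , j , +-suc j i , refl , refl

down↭up : ∀ k → down 0 k ↭ up 1 k
down↭up zero    = ↭-refl
down↭up (suc k) = ↭-trans (prep (suc k) (down↭up k))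
  (↭-trans (∷↭∷ʳ (suc k) (up 1 k)) (↭-reflexive (sym (up-∷ʳ 1 k))))

+-suc≡⇒< : ∀ a b {c} → a + suc b ≡ c → a < c
+-suc≡⇒< a b refl = m<m+n a z<s

reps : ℕ → List (List ℕ)
reps n = up 0 n
       ∷ (0 ∷ down 0 (pred n))
       ∷ (0 ∷ pred n ∷ up 1 (n ∸ 2))
       ∷ (0 ∷ down 0 (n ∸ 2) ++ [ pred n ])
       ∷ []

IsPerm-0∷ : ∀ N {xs} → xs ↭ up 1 (suc N) → IsPerm (suc (suc N)) (0 ∷ xs)
IsPerm-0∷ N p = ↭-trans (prep 0 p) (↭-reflexive (up≡upTo (suc (suc N))))

reps-InAv : ∀ N → All (InAv (suc (suc N))) (reps (suc (suc N)))
reps-InAv N =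
  ¬HasOpposed⇒InAv (↭-reflexive (up≡upTo (suc (suc N)))) ↻-refl
    (increasing⇒¬HasOpposed (up-increasing 0 (suc (suc N)))) ∷
  ¬HasOpposed⇒InAv (IsPerm-0∷ N (down↭up (suc N))) ↻-refl
    (min∷decreasing⇒¬HasOpposed (down-lowerBound 0 (suc N)) (down-decreasing 0 (suc N))) ∷
  ¬HasOpposed⇒InAv (IsPerm-0∷ N (↭-trans (∷↭∷ʳ (suc N) (up 1 N)) up1N∷ʳ)) ↻-refl
    (min∷max∷increasing⇒¬HasOpposed z<s (up-lowerBound 1 N) (up-upperBound 1 N) (up-increasing 1 N)) ∷
  ¬HasOpposed⇒InAv (IsPerm-0∷ N (↭-trans (↭.++⁺ʳ [ suc N ] (down↭up N)) up1N∷ʳ))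
    (↻-swap (0 ∷ down 0 N) [ suc N ])
    (max∷min∷decreasing⇒¬HasOpposed z<s (down-lowerBound 0 N) (down-upperBound 0 N) (down-decreasing 0 N)) ∷
  []
  where
  up1N∷ʳ : up 1 N ++ [ suc N ] ↭ up 1 (suc N)
  up1N∷ʳ = ↭-reflexive (sym (up-∷ʳ 1 N))

reps-unique : ∀ m → Unique (reps (suc (suc (suc (suc m)))))
reps-unique m = ((λ ()) ∷ (λ ()) ∷ (λ ()) ∷ []) ∷ ((λ ()) ∷ (λ ()) ∷ []) ∷ ((λ ()) ∷ []) ∷ [] ∷ []

ZeroFirst : List ℕ → Set
ZeroFirst σ = ∃[ rest ] (σ ≡ 0 ∷ rest × All (0 <_) rest)

reps-ZeroFirst : ∀ N → All ZeroFirst (reps (suc (suc N)))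
reps-ZeroFirst N =
  (_ , refl , up-lowerBound 1 (suc N)) ∷
  (_ , refl , down-lowerBound 0 (suc N)) ∷
  (_ , refl , z<s ∷ up-lowerBound 1 N) ∷
  (_ , refl , Allₚ.++⁺ (down-lowerBound 0 N) (z<s ∷ [])) ∷
  []

head-drop-++ : ∀ {P : ℕ → Set} {xs zs y ys} k → All P xs → k < length xs →
  drop k xs ++ zs ≡ y ∷ ys → P y
head-drop-++ zero    (px ∷ _)  _         refl = px
head-drop-++ (suc k) (_ ∷ pxs) (s≤s k<) e    = head-drop-++ k pxs k< e

SameCyclic-ZeroFirst : ∀ {σ τ} → ZeroFirst σ → ZeroFirst τ → SameCyclic σ τ → σ ≡ τ
SameCyclic-ZeroFirst _ _ (zero , _ , e) = trans (sym (++-identityʳ _)) e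
SameCyclic-ZeroFirst (_ , refl , pos) (_ , refl , _) (suc k , s≤s k< , e) =
  ⊥-elim (<-irrefl refl (head-drop-++ k pos k< e))

IsPerm-suc⁻ : ∀ n {σ} → IsPerm (suc n) σ → ∃₂ λ xs ys → σ ≡ xs ++ n ∷ ys × IsPerm n (xs ++ ys)
IsPerm-suc⁻ n p = ↭-∷ʳ⁻ n (↭-trans p (↭-reflexive (sym (upTo-∷ʳ n))))

classes : ℕ → List (List ℕ)
classes 0 = [ [] ]
classes 1 = [ 0 ∷ [] ]
classes 2 = [ 0 ∷ 1 ∷ [] ]
classes 3 = (0 ∷ 1 ∷ 2 ∷ []) ∷ (0 ∷ 2 ∷ 1 ∷ []) ∷ []
classes n@(suc (suc (suc (suc _)))) = reps n

Classified : ℕ → List ℕ → Set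
Classified n σ = ∃[ R ] (R ∈ classes n × σ ↻ R)

InsertionClosed : ℕ → Set
InsertionClosed n = ∀ {R} → R ∈ classes n → ∀ ps qs → R ≡ ps ++ qs →
  Avoids (ps ++ n ∷ qs) → Classified (suc n) (ps ++ n ∷ qs)

insertionClosed-0 : InsertionClosed 0
insertionClosed-0 (here refl) []      [] refl _ = _ , here refl , ↻-refl
insertionClosed-0 (here refl) (_ ∷ _) _  ()   _

insertionClosed-1 : InsertionClosed 1
insertionClosed-1 (here refl) []          _ refl _ = _ , here refl , ↻-swap [ 1 ] [ 0 ]
insertionClosed-1 (here refl) (_ ∷ [])    _ refl _ = _ , here refl , ↻-refl
insertionClosed-1 (here refl) (_ ∷ _ ∷ _) _ ()   _

insertionClosed-2 : InsertionClosed 2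
insertionClosed-2 (here refl) []              _ refl _ = _ , here refl , ↻-swap [ 2 ] (0 ∷ 1 ∷ [])
insertionClosed-2 (here refl) (_ ∷ [])        _ refl _ = _ , there (here refl) , ↻-refl
insertionClosed-2 (here refl) (_ ∷ _ ∷ [])    _ refl _ = _ , here refl , ↻-refl
insertionClosed-2 (here refl) (_ ∷ _ ∷ _ ∷ _) _ ()   _

insertionClosed-3 : InsertionClosed 3
insertionClosed-3 (here refl) []                  _ refl _  = _ , here refl , ↻-swap [ 3 ] (0 ∷ 1 ∷ 2 ∷ [])
insertionClosed-3 (here refl) (_ ∷ [])            _ refl _  = _ , there (there (here refl)) , ↻-refl
insertionClosed-3 (here refl) (_ ∷ _ ∷ [])        _ refl av =
  ⊥-elim (refute-1243 av ↻-refl ⊆-refl z<s (s<s z<s) (s<s (s<s z<s)))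
insertionClosed-3 (here refl) (_ ∷ _ ∷ _ ∷ [])    _ refl _  = _ , here refl , ↻-refl
insertionClosed-3 (here refl) (_ ∷ _ ∷ _ ∷ _ ∷ _) _ ()   _
insertionClosed-3 (there (here refl)) []                  _ refl _  =
  _ , there (there (there (here refl))) , ↻-swap [ 3 ] (0 ∷ 2 ∷ 1 ∷ [])
insertionClosed-3 (there (here refl)) (_ ∷ [])            _ refl _  = _ , there (here refl) , ↻-refl
insertionClosed-3 (there (here refl)) (_ ∷ _ ∷ [])        _ refl av =
  ⊥-elim (refute-1342 av ↻-refl ⊆-refl z<s (s<s z<s) (s<s (s<s z<s)))
insertionClosed-3 (there (here refl)) (_ ∷ _ ∷ _ ∷ [])    _ refl _  = _ , there (there (there (here refl))) , ↻-refl
insertionClosed-3 (there (here refl)) (_ ∷ _ ∷ _ ∷ _ ∷ _) _ ()   _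

module InsertMax (m : ℕ) where
  N n : ℕ
  N = suc (suc m)
  n = suc (suc N)

  -- Unless n goes first, last or right after 0, the entries around n form 0 a n (a + 1),
  -- a 1243.
  insert-A : ∀ ps qs → up 0 n ≡ ps ++ qs → Avoids (ps ++ n ∷ qs) → Classified (suc n) (ps ++ n ∷ qs)
  insert-A ps qs e av with up-split 0 n ps qs e
  ... | i , zero , i+0≡n , refl , refl with trans (sym (+-identityʳ i)) i+0≡n
  ...   | refl = _ , here refl , ↻-reflexive (sym (up-∷ʳ 0 n))
  insert-A ps qs e av | zero , suc j , refl , refl , refl =
    _ , here refl , ↻-trans (↻-swap [ n ] (up 0 n)) (↻-reflexive (sym (up-∷ʳ 0 n)))
  insert-A ps qs e av | suc zero , suc j , refl , refl , refl = _ , there (there (here refl)) , ↻-refl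
  insert-A ps qs e av | suc (suc i) , suc j , i+j≡n , refl , refl =
    ⊥-elim (refute-1243 av ↻-refl (refl ∷ ++⁺ (from∈ (∈-up-last 1 i)) (refl ∷ refl ∷ minimum _))
      z<s (n<1+n (suc i)) (+-suc≡⇒< (suc (suc i)) j i+j≡n))

  -- Unless n goes first, last or right after 0, the entries around n form 0 (a + 1) n a,
  -- a 1342.
  insert-B : ∀ ps qs → 0 ∷ down 0 (suc N) ≡ ps ++ qs → Avoids (ps ++ n ∷ qs) →
    Classified (suc n) (ps ++ n ∷ qs)
  insert-B [] qs refl av = _ , there (there (there (here refl))) , ↻-swap [ n ] (0 ∷ down 0 (suc N))
  insert-B (_ ∷ ps) qs e av with ∷-injective e
  ... | refl , e′ with down-split (suc N) ps qs e′
  ...   | zero , j , j+0≡ , refl , refl with trans (sym (+-identityʳ j)) j+0≡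
  ...     | refl = _ , there (here refl) , ↻-refl
  insert-B (_ ∷ ps) qs e av | refl , e′ | suc i , zero , refl , refl , refl =
    _ , there (there (there (here refl))) , ↻-refl
  insert-B (_ ∷ ps) qs e av | refl , e′ | suc i , suc j , j+i≡ , refl , refl =
    ⊥-elim (refute-1342 av ↻-refl (refl ∷ ++⁺ (from∈ (∈-down-last (suc j) i)) (refl ∷ refl ∷ minimum _))
      z<s (n<1+n (suc j)) (s<s (+-suc≡⇒< (suc j) i j+i≡)))

  C : List ℕ
  C = 0 ∷ suc N ∷ up 1 N

  -- 1 (n−2) n (n−1) in the rotation 1 … (n−2) n 0 (n−1).
  C∷ʳn-contains-1243 : ¬ Avoids (C ++ [ n ])
  C∷ʳn-contains-1243 av =
    refute-1243 av (↻-swap (0 ∷ suc N ∷ []) (up 1 N ++ [ n ]))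
      (refl ∷ ++⁺ (++⁺ (from∈ (∈-up-last 2 m)) ⊆-refl) (0 ∷ʳ ⊆-refl))
      (s<s z<s) (n<1+n N) (n<1+n (suc N))

  insert-C : ∀ ps qs → C ≡ ps ++ qs → Avoids (ps ++ n ∷ qs) → Classified (suc n) (ps ++ n ∷ qs)
  insert-C [] qs refl av = ⊥-elim (C∷ʳn-contains-1243 (Avoids-↻ (↻-swap [ n ] C) av))
  insert-C (_ ∷ []) qs refl av =
    ⊥-elim (refute-1243 av (↻-swap (0 ∷ n ∷ suc N ∷ []) (up 1 N))
      (refl ∷ ++⁺ (from∈ (∈-up-last 2 m)) (0 ∷ʳ refl ∷ refl ∷ []))
      (s<s z<s) (n<1+n N) (n<1+n (suc N)))
  insert-C (_ ∷ _ ∷ ps) qs e av with ∷-injective e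
  ... | refl , e₁ with ∷-injective e₁
  ...   | refl , e₂ with up-split 1 N ps qs e₂
  ...     | i , zero , i+0≡N , refl , refl with trans (sym (+-identityʳ i)) i+0≡N
  ...       | refl = ⊥-elim (C∷ʳn-contains-1243 av)
  insert-C (_ ∷ _ ∷ ps) qs e av | refl , _ | refl , _ | zero , suc j , refl , refl , refl =
    ⊥-elim (refute-1342 av ↻-refl (refl ∷ refl ∷ refl ∷ refl ∷ minimum _) z<s (s<s z<s) (n<1+n (suc N)))
  insert-C (_ ∷ _ ∷ ps) qs e av | refl , _ | refl , _ | suc i , suc j , i+j≡N , refl , refl =
    ⊥-elim (refute-1243 av ↻-refl (refl ∷ _ ∷ʳ ++⁺ (from∈ (∈-up-last 1 i)) (refl ∷ refl ∷ minimum _))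
      z<s (n<1+n (suc i)) (s<s (m<n⇒m<1+n (+-suc≡⇒< (suc i) j i+j≡N))))

  D : List ℕ
  D = 0 ∷ down 0 N ++ [ suc N ]

  -- 1 (n−1) n 2 in the rotation 1 (n−1) n 0 (n−2) … 2.
  D∷ʳn-contains-1342 : ¬ Avoids (D ++ [ n ])
  D∷ʳn-contains-1342 av =
    refute-1342 av (↻-trans (↻-reflexive D∷ʳn≡) (↻-swap (0 ∷ down 1 (suc m)) (1 ∷ suc N ∷ n ∷ [])))
      (refl ∷ refl ∷ refl ∷ 0 ∷ʳ from∈ (∈-down-last 1 m))
      (s<s z<s) (s<s (s<s z<s)) (n<1+n (suc N))
    where
    open ≡-Reasoning
    D∷ʳn≡ : D ++ [ n ] ≡ (0 ∷ down 1 (suc m)) ++ (1 ∷ suc N ∷ n ∷ [])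
    D∷ʳn≡ = cong (0 ∷_) (begin
      (down 0 N ++ [ suc N ]) ++ [ n ]             ≡⟨ ++-assoc (down 0 N) [ suc N ] [ n ] ⟩
      down 0 N ++ suc N ∷ n ∷ []                   ≡⟨ cong (_++ suc N ∷ n ∷ []) (sym (down-++ 1 (suc m))) ⟩
      (down 1 (suc m) ++ [ 1 ]) ++ suc N ∷ n ∷ []  ≡⟨ ++-assoc (down 1 (suc m)) [ 1 ] (suc N ∷ n ∷ []) ⟩
      down 1 (suc m) ++ 1 ∷ suc N ∷ n ∷ []         ∎)

  insert-D : ∀ ps qs → D ≡ ps ++ qs → Avoids (ps ++ n ∷ qs) → Classified (suc n) (ps ++ n ∷ qs)
  insert-D [] qs refl av = ⊥-elim (D∷ʳn-contains-1342 (Avoids-↻ (↻-swap [ n ] D) av))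
  insert-D (_ ∷ ps) qs e av with ∷-injective e
  ... | refl , e′ with ++-≡-++-split (down 0 N) [ suc N ] ps qs e′
  ...   | inj₁ ([] , refl , refl) =
    ⊥-elim (refute-1243 av ↻-refl (refl ∷ ++⁺ (from∈ (∈-++⁺ˡ (∈-down-last 0 (suc m)))) (refl ∷ refl ∷ []))
      z<s (s<s z<s) (n<1+n (suc N)))
  ...   | inj₁ (_ ∷ [] , refl , refl) = ⊥-elim (D∷ʳn-contains-1342 av)
  ...   | inj₂ (ws , e″ , refl) with down-split N ps ws e″
  ...     | zero , j , j+0≡N , refl , refl with trans (sym (+-identityʳ j)) j+0≡N
  ...       | refl =
    ⊥-elim (refute-1342 av (↻-trans (↻-reflexive 0∷n∷D≡) (↻-swap (0 ∷ n ∷ down 1 (suc m)) (1 ∷ suc N ∷ [])))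
      (refl ∷ refl ∷ 0 ∷ʳ refl ∷ from∈ (∈-down-last 1 m))
      (s<s z<s) (s<s (s<s z<s)) (n<1+n (suc N)))
    where
    0∷n∷D≡ : 0 ∷ n ∷ down 0 N ++ [ suc N ] ≡ (0 ∷ n ∷ down 1 (suc m)) ++ (1 ∷ suc N ∷ [])
    0∷n∷D≡ = cong (λ xs → 0 ∷ n ∷ xs)
      (trans (cong (_++ [ suc N ]) (sym (down-++ 1 (suc m)))) (++-assoc (down 1 (suc m)) [ 1 ] [ suc N ]))
  insert-D (_ ∷ ps) qs e av | refl , e′ | inj₂ (ws , e″ , refl) | suc i , zero , refl , refl , refl =
    ⊥-elim (refute-1243 av ↻-refl (refl ∷ ++⁺ (from∈ (∈-down-last 0 (suc m))) (refl ∷ refl ∷ []))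
      z<s (s<s z<s) (n<1+n (suc N)))
  insert-D (_ ∷ ps) qs e av | refl , e′ | inj₂ (ws , e″ , refl) | suc i , suc j , j+i≡N , refl , refl =
    ⊥-elim (refute-1342 av ↻-refl (refl ∷ ++⁺ (from∈ (∈-down-last (suc j) i)) (refl ∷ refl ∷ minimum _))
      z<s (n<1+n (suc j)) (s<s (m<n⇒m<1+n (+-suc≡⇒< (suc j) i j+i≡N))))

  insertionClosed : InsertionClosed n
  insertionClosed (here refl)                         = insert-A
  insertionClosed (there (here refl))                 = insert-B
  insertionClosed (there (there (here refl)))         = insert-C
  insertionClosed (there (there (there (here refl)))) = insert-D

insertionClosed : ∀ n → InsertionClosed n
insertionClosed 0                           = insertionClosed-0
insertionClosed 1                           = insertionClosed-1
insertionClosed 2                           = insertionClosed-2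
insertionClosed 3                           = insertionClosed-3
insertionClosed (suc (suc (suc (suc m)))) = InsertMax.insertionClosed m

classify : ∀ n {σ} → IsPerm n σ → Avoids σ → Classified n σ
classify zero p _ with refl ← ↭-empty-inv p = _ , here refl , ↻-refl
classify (suc n) p av with IsPerm-suc⁻ n p
... | xs , ys , refl , p′ with classify n p′ (Avoids-delete xs ys n av)
...   | R , R∈ , r with ↻-insert n r
...     | ps , qs , R≡ , r′ with insertionClosed n R∈ ps qs R≡ (Avoids-↻ r′ av)
...       | R′ , R′∈ , r″ = R′ , R′∈ , ↻-trans r′ r″

mainTheorem7 : (n : ℕ) → 4 ≤ n →
    Σ (Fin 4 → List ℕ) λ r →
    ((i : Fin 4) → InAv n (r i))
    × ((i j : Fin 4) → SameCyclic (r i) (r j) → i ≡ j)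
    × ((σ : List ℕ) → InAv n σ → ∃[ i ] SameCyclic σ (r i))
mainTheorem7 n@(suc (suc (suc (suc m)))) (s≤s (s≤s (s≤s (s≤s _)))) =
  lookup (reps n) ,
  (λ i → All.lookup (reps-InAv N) (∈-lookup i)) ,
  (λ i j sc → lookup-injective (reps-unique m)
     (SameCyclic-ZeroFirst (zeroFirst i) (zeroFirst j) sc)) ,
  λ σ inAv → let R , R∈ , r = classify n (proj₁ inAv) (InAv⇒Avoids inAv) in
    index R∈ , subst (SameCyclic σ) (lookup-index R∈) (↻⇒SameCyclic r (nonempty R∈))
  where
  N = suc (suc m)
  zeroFirst : ∀ i → ZeroFirst (lookup (reps n) i)
  zeroFirst i = All.lookup (reps-ZeroFirst N) (∈-lookup i)
  nonempty : ∀ {R} → R ∈ reps n → 0 < length R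
  nonempty R∈ with All.lookup (reps-ZeroFirst N) R∈
  ... | _ , refl , _ = z<s
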